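{- Let $\mathcal{A}$ be a generalized Büchi automaton with $n$ states and $k$ colours, i.e., a TELA with acceptance condition $\bigwedge_{0\le j<k}\mathrm{Inf}(j)$, and let $\mathcal{B}$ be the Büchi automaton constructed from $\mathcal{A}$ as described in the context. Then the number of states of $\mathcal{B}$ is in $O(k^n\cdot\mathrm{tight}(n+1))$, which (using the known estimate $\mathrm{tight}(n)\approx(0.76n)^n$) is $O(n(0.76nk)^n)$.
   Context: TELA: $\mathcal{A}=(Q,\delta,I,\Gamma,p,\mathit{Acc})$ with finite states $Q$, transitions $\delta\subseteq Q\times\Sigma\times Q$, initial states $I$, colours $\Gamma=\{0,\dots,k-1\}$, colouring $p:\delta\to2^\Gamma$; a run is accepting iff the set of colours of transitions seen infinitely often satisfies $\mathit{Acc}$ ($\mathrm{Inf}(c)$: $c$ in the set). $\delta(S,a)=\{q'\mid\exists q\in S:(q,a,q')\in\delta\}$. $\overline{\mathit{Acc}}$: negation of $\mathit{Acc}$ in negation normal form with $\neg\mathrm{Inf}(c)$ written as the variable $c$ (for the GBA condition this is $\bigvee_j j$); $\mathrm{Min}$: set of $\subseteq$-minimal sets $M\subseteq\Gamma$ satisfying it; $\mathrm{lex}$: its lexicographically smallest element. $\lfloor k\rfloor_{\mathrm{even}}$: largest even number $\le k$. $\mathrm{tight}(n)$: number of functions $f:\{1,\dots,n\}\to\omega$ whose maximum $r$ is odd and whose image contains $\{1,3,\dots,r\}$. Construction of $\mathcal{B}$ ($n=|Q|$): level rankings $f:Q\to\{0,\dots,2n\}$, $\mathrm{rank}(f)=\max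 f$; level models $\mu:Q\to\mathrm{Min}$, consistent w.r.t. $f$ if $\mu(q)=\mathrm{lex}$ whenever $f(q)$ even; $f$ is $(S,\mu)$-tight if $\mathrm{rank}(f)=r$ odd, $f(S)\supseteq\{1,3,\dots,r\}$, $f(Q\setminus S)=\{0\}$, $\mu$ consistent w.r.t. $f$; $\mathcal{T}$: the $f$ that are $(Q,\mu)$-tight for some $\mu$. $(f,\mu)\to_a(f',\mu')$ iff $\mu,\mu'$ consistent w.r.t. $f,f'$ and for all $q$, $q'\in\delta(q,a)$: $f'(q')\le f(q)$; if $p((q,a,q'))\cap\mu(q)\ne\emptyset$ then $f'(q')\le\lfloor f(q)\rfloor_{\mathrm{even}}$; if $\mu'(q')\neq\mu(q)$ then $f'(q')\le\lfloor f(q)\rfloor_{\mathrm{even}}$. $\mathcal{B}$ has states $2^Q\cup Q_2$, $Q_2$ = tuples $(S,O,f,i,\mu)$ with $f\in\mathcal{T}$ $(S,\mu)$-tight, $i\in\{0,2,\dots,2n-2\}$, $O\subseteq S\cap f^{ -1}(i)$; initial state $I$; transitions $S\xrightarrow{a}\delta(S,a)$, $S\xrightarrow{a}(\delta(S,a),\emptyset,f,0,\mu)\in Q_2$, and $(S,O,f,i,\mu)\xrightarrow{a}(S',O',f',i',\mu')$ iff $S'=\delta(S,a)$, $(f,\mu)\to_a(f',\mu')$, $\mathrm{rank}(f)=\mathrm{rank}(f')$, and either ($O=\emptyset$, $i'=(i+2)\bmod(\mathrm{rank}(f')+1)$, $O'=f'^{ -1}(i')$) or ($O\neq\emptyset$,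 $i'=i$, $O'=\delta(O,a)\cap f'^{ -1}(i)$); accepting transitions: $\emptyset\xrightarrow{a}\emptyset$ and transitions within $Q_2$ whose source has $O=\emptyset$. -}

module Defs where

open import Data.Bool.Base using (Bool; true; false; _∧_; _∨_; not; if_then_else_)
open import Data.Nat.Base using (ℕ; zero; suc; _+_; _*_; _∸_; _⊔_; _≡ᵇ_; _<ᵇ_; _%_)
open import Data.Fin.Base using (Fin; toℕ)
open import Data.Vec.Base as Vec using (Vec; []; _∷_; lookup; replicate; toList)
open import Data.List.Base as List using (List; []; _∷_; map; concatMap; upTo; allFin; filterᵇ; length; foldr)
open import Data.Bool.ListAction using (all; any)

allVecs : ∀ {A : Set} → List A → (n : ℕ) → List (Vec A n)
allVecs xs zero    = [] ∷ []
allVecs xs (suc n) = concatMap (λ x → map (x ∷_) (allVecs xs n)) xs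

Subset : ℕ → Set
Subset m = Vec Bool m

allSubsets : (m : ℕ) → List (Subset m)
allSubsets m = allVecs (true ∷ false ∷ []) m

_∈ᵇ_ : ∀ {m} → Fin m → Subset m → Bool
j ∈ᵇ M = lookup M j

_⊆ᵇ_ : ∀ {m} → Subset m → Subset m → Bool
_⊆ᵇ_ {m} M N = all (λ j → not (j ∈ᵇ M) ∨ (j ∈ᵇ N)) (allFin m)

isEven isOdd : ℕ → Bool
isEven x = (x % 2) ≡ᵇ 0
isOdd x = not (isEven x)

-- Generalized Büchi automata: TELA with Acc = ⋀_{0≤j<k} Inf(j),
-- states Q = Fin n, colours Γ = Fin k.

record GBA : Set₁ where
  field
    Alphabet : Set
    n        : ℕ
    k        : ℕ
    δ        : Fin n → Alphabet → Fin n → Set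
    I        : Fin n → Set
    p        : Fin n → Alphabet → Fin n → Subset k

-- The negated acceptance condition of a GBA, \overline{Acc} = ⋁_{j<k} j,
-- evaluated on a set M ⊆ Γ (variable j is true iff j ∈ M).
satNegGBA : (k : ℕ) → Subset k → Bool
satNegGBA k M = any (λ j → j ∈ᵇ M) (allFin k)

isMin : (k : ℕ) → Subset k → Bool
isMin k M = satNegGBA k M ∧
  all (λ M' → not ((M' ⊆ᵇ M) ∧ satNegGBA k M') ∨ (M ⊆ᵇ M')) (allSubsets k)

elems : ∀ {k} → Subset k → List ℕ
elems {k} M = map toℕ (filterᵇ (λ j → j ∈ᵇ M) (allFin k))

lexLeq : List ℕ → List ℕ → Bool
lexLeq []       _        = true
lexLeq (x ∷ xs) []       = false
lexLeq (x ∷ xs) (y ∷ ys) = (x <ᵇ y) ∨ ((x ≡ᵇ y) ∧ lexLeq xs ys)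

isLex : (k : ℕ) → Subset k → Bool
isLex k M = isMin k M ∧
  all (λ M' → not (isMin k M') ∨ lexLeq (elems M) (elems M')) (allSubsets k)

LevelRanking : ℕ → Set
LevelRanking n = Vec ℕ n

LevelModel : ℕ → ℕ → Set
LevelModel n k = Vec (Subset k) n

allRankings : (n : ℕ) → List (LevelRanking n)
allRankings n = allVecs (upTo (suc (n + n))) n

allLevelModels : (n k : ℕ) → List (LevelModel n k)
allLevelModels n k = allVecs (allSubsets k) n

rank : ∀ {n} → Vec ℕ n → ℕ
rank f = foldr _⊔_ 0 (toList f)

isLevelModel : (n k : ℕ) → LevelModel n k → Bool
isLevelModel n k μ = all (λ q → isMin k (lookup μ q)) (allFin n)

consistent : (n k : ℕ) → LevelRanking n → LevelModel n k → Bool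
consistent n k f μ = all (λ q → not (isEven (lookup f q)) ∨ isLex k (lookup μ q)) (allFin n)

isTight : (n k : ℕ) → Subset n → LevelModel n k → LevelRanking n → Bool
isTight n k S μ f =
  isOdd (rank f) ∧
  all (λ o → not (isOdd o) ∨ any (λ q → (q ∈ᵇ S) ∧ (lookup f q ≡ᵇ o)) (allFin n))
      (upTo (suc (rank f))) ∧
  all (λ q → (q ∈ᵇ S) ∨ (lookup f q ≡ᵇ 0)) (allFin n) ∧
  consistent n k f μ

inT : (n k : ℕ) → LevelRanking n → Bool
inT n k f = any (λ μ → isLevelModel n k μ ∧ isTight n k (replicate n true) μ f)
                (allLevelModels n k)

Q2Tuple : ℕ → ℕ → Set
Q2Tuple n k = Subset n × (Subset n × (LevelRanking n × (ℕ × LevelModel n k)))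
  where open import Data.Product.Base using (_×_)

open import Data.Product.Base using (_×_; _,_)

isQ2 : (n k : ℕ) → Q2Tuple n k → Bool
isQ2 n k (S , O , f , i , μ) =
  isLevelModel n k μ ∧
  inT n k f ∧
  isTight n k S μ f ∧
  all (λ q → not (q ∈ᵇ O) ∨ ((q ∈ᵇ S) ∧ (lookup f q ≡ᵇ i))) (allFin n)
  -- i ∈ {0,2,…,2n-2} is enforced by the enumeration below

q2Candidates : (n k : ℕ) → List (Q2Tuple n k)
q2Candidates n k =
  concatMap (λ S →
  concatMap (λ O →
  concatMap (λ f →
  concatMap (λ i →
  map (λ μ → (S , O , f , i , μ))
      (allLevelModels n k))
      (map (2 *_) (upTo n)))
      (allRankings n))
      (allSubsets n))
      (allSubsets n)

numQ2 : (n k : ℕ) → ℕ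
numQ2 n k = length (filterᵇ (isQ2 n k) (q2Candidates n k))

-- number of states of 𝓑 = |2^Q| + |Q₂|  (the union is disjoint)
numStatesB : GBA → ℕ
numStatesB A = length (allSubsets n) + numQ2 n k
  where open GBA A

-- tight(n): number of f : {1,…,n} → ω with max r odd and
-- {1,3,…,r} ⊆ image(f).  Such f necessarily have r ≤ 2n-1 (the
-- (r+1)/2 odd values must all be hit), so values range over {0,…,2n-1}.
isTightFun : (n : ℕ) → Vec ℕ n → Bool
isTightFun n f =
  isOdd (rank f) ∧
  all (λ o → not (isOdd o) ∨ any (λ q → lookup f q ≡ᵇ o) (allFin n))
      (upTo (suc (rank f)))

tight : ℕ → ℕ
tight n = length (filterᵇ (isTightFun n) (allVecs (upTo (n + n)) n))

-- For a generalized Büchi condition the negated acceptance condition is ⋁ⱼ j, whose minimal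
-- models are the singletons {j}; a level model is therefore a vector in Γⁿ, which accounts for
-- the factor kⁿ.  The rest (S, O, f, i) of a state of Q₂ is encoded injectively by a tight function
-- on n + 1 points.  Code q ∉ S by 0 and q ∈ S by f(q) + 2: this keeps the odd values 3, 5, …,
-- rank f + 2 attained and frees the value 1 for marking positions.  If O ≠ ∅, mark the positions
-- in O (their common code is i + 2, as O ⊆ f⁻¹(i)) and put i + 2 on the extra point; if O = ∅,
-- mark the single position i/2 < n and put the code it hides on the extra point.  With a bit
-- telling the two cases apart, |Q₂| ≤ 2 kⁿ tight(n+1); the subsets of Q are encoded the same way,
-- so |2^Q| ≤ tight(n+1) and |𝓑| ≤ 3 kⁿ tight(n+1).
module Submission where

open import Defs
open import Data.Bool.Base using (Bool; true; false; T; not; _∧_; _∨_; if_then_else_)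
open import Data.Bool.ListAction using (all; any)
open import Data.Bool.Properties using (T-∧; T-≡)
import Data.Bool.Properties as Bool
open import Data.Empty using (⊥-elim)
open import Data.Fin.Base using (Fin; zero; suc; toℕ; fromℕ<)
import Data.Fin.Properties as Fin
open import Data.Fin.Subset using (⁅_⁆; ⊥)
open import Data.Fin.Subset.Properties using (x∈⁅x⁆; x∈⁅y⁆⇒x≡y)
open import Data.Nat.Base
open import Data.Nat.Properties
open import Data.Product.Base using (Σ; ∃; _×_; _,_; proj₁; proj₂)
open import Data.List.Base
  using (List; []; _∷_; map; concatMap; upTo; allFin; filterᵇ; length; cartesianProduct)
open import Data.List.Properties using (length-map; length-++; length-tabulate)
open import Data.List.Relation.Unary.All as All using (All)
import Data.List.Relation.Unary.All.Properties as All
open import Data.List.Relation.Unary.AllPairs as AllPairs using ([]; _∷_)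
import Data.List.Relation.Unary.AllPairs.Properties as AllPairs
open import Data.List.Relation.Unary.Any using (here; there; satisfied)
import Data.List.Relation.Unary.Any.Properties as Any
open import Data.List.Relation.Unary.Unique.Propositional using (Unique)
import Data.List.Relation.Unary.Unique.Propositional.Properties as Unique
open import Data.List.Membership.Propositional using (_∈_; lose; find)
open import Data.List.Membership.Propositional.Properties
import Data.List.Membership.Setoid.Properties as SetoidMembership
open import Data.List.Relation.Binary.Subset.Propositional using (_⊆_)
open import Data.Vec.Base as Vec using (Vec; []; _∷_; lookup; head)
open import Data.Vec.Properties
  using (∷-injectiveʳ; []=⇒lookup; lookup⇒[]=; lookup-map; lookup-zipWith; lookup-replicate; lookup∘tabulate)
open import Data.Vec.Relation.Binary.Pointwise.Extensional using (ext; Pointwise-≡⇒≡)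
open import Function.Base using (_∘_; id)
open import Function.Bundles using (Equivalence)
open import Relation.Nullary using (¬_; yes; no)
open import Relation.Nullary.Decidable using (T?)
open import Relation.Binary.PropositionalEquality

private variable
  A B : Set
  xs ys : List A

Unique-lookup-injective : Unique xs → ∀ i j →
  Data.List.Base.lookup xs i ≡ Data.List.Base.lookup xs j → i ≡ j
Unique-lookup-injective (_ ∷ _)  zero    zero    _  = refl
Unique-lookup-injective (x∉ ∷ _) zero    (suc j) eq = ⊥-elim (All.lookup x∉ (∈-lookup j) eq)
Unique-lookup-injective (x∉ ∷ _) (suc i) zero    eq = ⊥-elim (All.lookup x∉ (∈-lookup i) (sym eq))
Unique-lookup-injective (_ ∷ u)  (suc i) (suc j) eq = cong suc (Unique-lookup-injective u i j eq)

Unique∧⊆⇒length≤ : Unique xs → xs ⊆ ys → length xs ≤ length ys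
Unique∧⊆⇒length≤ u xs⊆ys = Fin.injective⇒≤ λ {i} {j} same-index →
  Unique-lookup-injective u i j
    (SetoidMembership.index-injective (setoid _) (xs⊆ys (∈-lookup i)) (xs⊆ys (∈-lookup j)) same-index)

All-concatMap⁺ : {P : B → Set} (F : A → List B) {xs : List A} →
  (∀ {x} → x ∈ xs → All P (F x)) → All P (concatMap F xs)
All-concatMap⁺ F PF = All.concat⁺ (All.map⁺ (All.tabulate PF))

Unique-concatMap⁺ : {F : A → List B} (π : B → A) → Unique xs →
  (∀ x → All (λ z → π z ≡ x) (F x)) → (∀ x → Unique (F x)) → Unique (concatMap F xs)
Unique-concatMap⁺ {xs = xs} {F = F} π u πF uF =
  Unique.concat⁺ (All.map⁺ (All.universal uF xs)) (AllPairs.map⁺ (AllPairs.map disjoint u))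
  where
  disjoint : ∀ {x y} → x ≢ y → ∀ {z} → ¬ (z ∈ F x × z ∈ F y)
  disjoint {x} {y} x≢y (z∈Fx , z∈Fy) =
    x≢y (trans (sym (All.lookup (πF x) z∈Fx)) (All.lookup (πF y) z∈Fy))

length-concatMap : {F : A → List B} (c : ℕ) → (∀ x → length (F x) ≡ c) →
  length (concatMap F xs) ≡ length xs * c
length-concatMap {xs = []}     c lenF = refl
length-concatMap {xs = x ∷ xs} {F = F} c lenF =
  trans (length-++ (F x)) (cong₂ _+_ (lenF x) (length-concatMap {xs = xs} {F = F} c lenF))

length-cartesianProduct : (xs : List A) (ys : List B) →
  length (cartesianProduct xs ys) ≡ length xs * length ys
length-cartesianProduct []       ys = refl
length-cartesianProduct (x ∷ xs) ys =
  trans (length-++ (map (x ,_) ys)) (cong₂ _+_ (length-map (x ,_) ys) (length-cartesianProduct xs ys))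

∈-allVecs⁺ : (xs : List A) {n : ℕ} (v : Vec A n) → (∀ q → lookup v q ∈ xs) → v ∈ allVecs xs n
∈-allVecs⁺ xs []      entries = here refl
∈-allVecs⁺ xs (x ∷ v) entries =
  ∈-concatMap⁺ _ (lose (entries zero) (∈-map⁺ (x ∷_) (∈-allVecs⁺ xs v (entries ∘ suc))))

∈-allVecs⁻ : (xs : List A) {n : ℕ} {v : Vec A n} → v ∈ allVecs xs n → ∀ q → lookup v q ∈ xs
∈-allVecs⁻ xs {suc n} v∈ q
  with x , x∈xs , v∈x∷ ← find (∈-concatMap⁻ (λ x → map (x ∷_) (allVecs xs n)) {xs = xs} v∈)
  with w , w∈ , refl ← ∈-map⁻ (x ∷_) v∈x∷
  with q
... | zero  = x∈xs
... | suc q = ∈-allVecs⁻ xs w∈ q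

allVecs-Unique : (xs : List A) (n : ℕ) → Unique xs → Unique (allVecs xs n)
allVecs-Unique xs zero    u = All.[] ∷ []
allVecs-Unique xs (suc n) u = Unique-concatMap⁺ head u
  (λ x → All.map⁺ (All.universal (λ _ → refl) _))
  (λ x → Unique.map⁺ ∷-injectiveʳ (allVecs-Unique xs n u))

length-allVecs : (xs : List A) (n : ℕ) → length (allVecs xs n) ≡ length xs ^ n
length-allVecs xs zero    = refl
length-allVecs xs (suc n) = length-concatMap {xs = xs} (length xs ^ n)
  (λ x → trans (length-map (x ∷_) (allVecs xs n)) (length-allVecs xs n))

∈-Bool : ∀ b → b ∈ true ∷ false ∷ []
∈-Bool true  = here refl
∈-Bool false = there (here refl)

∈-allSubsets : ∀ {m} (M : Subset m) → M ∈ allSubsets m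
∈-allSubsets M = ∈-allVecs⁺ _ M λ q → ∈-Bool (lookup M q)

allSubsets-Unique : ∀ m → Unique (allSubsets m)
allSubsets-Unique m = allVecs-Unique _ m (((λ ()) All.∷ All.[]) ∷ All.[] ∷ [])

evens : ℕ → List ℕ
evens n = map (2 *_) (upTo n)

module _ (n k : ℕ) where

  withModel : Subset n → Subset n → LevelRanking n → ℕ → List (Q2Tuple n k)
  withModel S O f i = map (λ μ → S , O , f , i , μ) (allLevelModels n k)

  withLevel : Subset n → Subset n → LevelRanking n → List (Q2Tuple n k)
  withLevel S O f = concatMap (withModel S O f) (evens n)

  withRanking : Subset n → Subset n → List (Q2Tuple n k)
  withRanking S O = concatMap (withLevel S O) (allRankings n)

  withO : Subset n → List (Q2Tuple n k)
  withO S = concatMap (withRanking S) (allSubsets n)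

  module _ {P : Q2Tuple n k → Set} where

    All-withModel : ∀ S O f i → (∀ {μ} → P (S , O , f , i , μ)) → All P (withModel S O f i)
    All-withModel S O f i h = All.map⁺ (All.universal (λ _ → h) _)

    All-withLevel : ∀ S O f → (∀ {i μ} → i ∈ evens n → P (S , O , f , i , μ)) → All P (withLevel S O f)
    All-withLevel S O f h =
      All-concatMap⁺ (withModel S O f) {xs = evens n} λ i∈ → All-withModel S O f _ (h i∈)

    All-withRanking : ∀ S O → (∀ {f i μ} → f ∈ allRankings n → i ∈ evens n → P (S , O , f , i , μ)) →
      All P (withRanking S O)
    All-withRanking S O h =
      All-concatMap⁺ (withLevel S O) {xs = allRankings n} λ f∈ → All-withLevel S O _ (h f∈)

    All-withO : ∀ S → (∀ {O f i μ} → f ∈ allRankings n → i ∈ evens n → P (S , O , f , i , μ)) →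
      All P (withO S)
    All-withO S h = All-concatMap⁺ (withRanking S) {xs = allSubsets n} λ _ → All-withRanking S _ h

  q2Candidates-ranges :
    All (λ (S , O , f , i , μ) → f ∈ allRankings n × i ∈ evens n) (q2Candidates n k)
  q2Candidates-ranges = All-concatMap⁺ withO {xs = allSubsets n} λ _ → All-withO _ _,_

  q2Candidates-Unique : Unique (q2Candidates n k)
  q2Candidates-Unique =
    Unique-concatMap⁺ proj₁ (allSubsets-Unique n)
      (λ S → All-withO S λ _ _ → refl) λ S →
    Unique-concatMap⁺ (proj₁ ∘ proj₂) (allSubsets-Unique n)
      (λ O → All-withRanking S O λ _ _ → refl) λ O →
    Unique-concatMap⁺ (proj₁ ∘ proj₂ ∘ proj₂) (allVecs-Unique _ n (Unique.upTo⁺ _))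
      (λ f → All-withLevel S O f λ _ → refl) λ f →
    Unique-concatMap⁺ (proj₁ ∘ proj₂ ∘ proj₂ ∘ proj₂) (Unique.map⁺ (*-cancelˡ-≡ _ _ 2) (Unique.upTo⁺ n))
      (λ i → All-withModel S O f i refl) λ i →
    Unique.map⁺ (λ { refl → refl }) (allVecs-Unique _ n (allSubsets-Unique k))

T-∧⁻ : ∀ {a b} → T (a ∧ b) → T a × T b
T-∧⁻ = Equivalence.to T-∧

T-⇒ : ∀ {a b} → T (not a ∨ b) → T a → T b
T-⇒ {true} h _ = h

T-∨-resolve : ∀ {a b} → T (a ∨ b) → a ≡ false → T b
T-∨-resolve h refl = h

T-all⁻ : (p : A → Bool) {x : A} → T (all p xs) → x ∈ xs → T (p x)
T-all⁻ {xs = xs} p h = All.lookup (All.all⁺ p xs h)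

¬T⇒≡false : ∀ {b} → ¬ T b → b ≡ false
¬T⇒≡false {false} _  = refl
¬T⇒≡false {true}  ¬T = ⊥-elim (¬T _)

T-⇒-intro : ∀ {a b} → (T a → T b) → T (not a ∨ b)
T-⇒-intro {true}  h = h _
T-⇒-intro {false} h = _

lookup≤rank : ∀ {n} (v : Vec ℕ n) q → lookup v q ≤ rank v
lookup≤rank (x ∷ v) zero    = m≤m⊔n x (rank v)
lookup≤rank (x ∷ v) (suc q) = ≤-trans (lookup≤rank v q) (m≤n⊔m x (rank v))

rank-lub : ∀ {n} (v : Vec ℕ n) {m} → (∀ q → lookup v q ≤ m) → rank v ≤ m
rank-lub []      bound = z≤n
rank-lub (x ∷ v) bound = ⊔-lub (bound zero) (rank-lub v (bound ∘ suc))

rank≡ : ∀ {n} (v : Vec ℕ n) {m} → (∀ q → lookup v q ≤ m) → (∃ λ q → lookup v q ≡ m) →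
  rank v ≡ m
rank≡ v bound (q , vq≡m) = ≤-antisym (rank-lub v bound) (subst (_≤ rank v) vq≡m (lookup≤rank v q))

odd⇒1≤ : ∀ {R} → T (isOdd R) → 1 ≤ R
odd⇒1≤ {suc _} _ = s≤s z≤n

¬isOdd-double : ∀ j → ¬ T (isOdd (j + j))
¬isOdd-double zero    ()
¬isOdd-double (suc j) rewrite +-suc j j = ¬isOdd-double j

record IsQ2State {n k : ℕ} (S O : Subset n) (f : LevelRanking n) (i : ℕ) (μ : LevelModel n k) :
                 Set where
  field
    rank-odd     : T (isOdd (rank f))
    odd-attained : ∀ {o} → o ≤ rank f → T (isOdd o) → ∃ λ q → lookup S q ≡ true × lookup f q ≡ o
    outside-zero : ∀ q → lookup S q ≡ false → lookup f q ≡ 0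
    O-level      : ∀ q → lookup O q ≡ true → lookup S q ≡ true × lookup f q ≡ i
    μ-minimal    : ∀ q → T (isMin k (lookup μ q))
    level        : Fin n
    i≡level      : i ≡ 2 * toℕ level
    rank<2n      : rank f < n + n

module _ {n k : ℕ} {S O : Subset n} {f : LevelRanking n} {i : ℕ} {μ : LevelModel n k} where

  private
    hitBy : ℕ → Bool
    hitBy o = any (λ q → (q ∈ᵇ S) ∧ (lookup f q ≡ᵇ o)) (allFin n)
    oddHit : ℕ → Bool
    oddHit o = not (isOdd o) ∨ hitBy o
    outsideZero : Fin n → Bool
    outsideZero q = (q ∈ᵇ S) ∨ (lookup f q ≡ᵇ 0)
    inLevelOrOutsideO : Fin n → Bool
    inLevelOrOutsideO q = not (q ∈ᵇ O) ∨ ((q ∈ᵇ S) ∧ (lookup f q ≡ᵇ i))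
    minimalModel : Fin n → Bool
    minimalModel q = isMin k (lookup μ q)

  isQ2⇒IsQ2State : T (isQ2 n k (S , O , f , i , μ)) → f ∈ allRankings n → i ∈ evens n →
    IsQ2State S O f i μ
  isQ2⇒IsQ2State isQ2-true f∈ i∈
    with models , inT-tight-O ← T-∧⁻ {isLevelModel n k μ} isQ2-true
    with _ , tight-O ← T-∧⁻ {inT n k f} inT-tight-O
    with isTight-true , O-cond ← T-∧⁻ {isTight n k S μ f} tight-O
    with rank-odd , hits-zeros-consistent ← T-∧⁻ {isOdd (rank f)} isTight-true
    with hits , zeros-consistent ← T-∧⁻ {all oddHit (upTo (suc (rank f)))} hits-zeros-consistent
    with zeros , _ ← T-∧⁻ {all outsideZero (allFin n)} zeros-consistent
    with j , j∈ , refl ← ∈-map⁻ (2 *_) i∈ = record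
    { rank-odd     = rank-odd
    ; odd-attained = λ o≤r o-odd →
                       attained (T-⇒ (T-all⁻ oddHit hits (∈-upTo⁺ (s≤s o≤r))) o-odd)
    ; outside-zero = λ q Sq≡false →
                       ≡ᵇ⇒≡ _ 0 (T-∨-resolve (T-all⁻ outsideZero zeros (∈-allFin q)) Sq≡false)
    ; O-level      = λ q Oq≡true → inLevel
                       (T-⇒ (T-all⁻ inLevelOrOutsideO O-cond (∈-allFin q)) (Equivalence.from T-≡ Oq≡true))
    ; μ-minimal    = λ q → T-all⁻ minimalModel models (∈-allFin q)
    ; level        = fromℕ< (∈-upTo⁻ j∈)
    ; i≡level      = cong (2 *_) (sym (Fin.toℕ-fromℕ< (∈-upTo⁻ j∈)))
    ; rank<2n      = ≤∧≢⇒< (rank-lub f (λ q → ≤-pred (∈-upTo⁻ (∈-allVecs⁻ _ f∈ q))))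
                           (λ r≡2n → ¬isOdd-double n (subst (T ∘ isOdd) r≡2n rank-odd))
    }
    where
    inLevel : ∀ {q} {o} → T (lookup S q ∧ (lookup f q ≡ᵇ o)) → lookup S q ≡ true × lookup f q ≡ o
    inLevel h with Sq , fq≡o ← T-∧⁻ h = Equivalence.to T-≡ Sq , ≡ᵇ⇒≡ _ _ fq≡o
    attained : ∀ {o} → T (hitBy o) → ∃ λ q → lookup S q ≡ true × lookup f q ≡ o
    attained h with q , hq ← satisfied (Any.any⁻ _ (allFin n) h) = q , inLevel hq

T-lookup-⁅⁆⁻ : ∀ {k} {q j : Fin k} → T (lookup ⁅ j ⁆ q) → q ≡ j
T-lookup-⁅⁆⁻ {q = q} {j} h = x∈⁅y⁆⇒x≡y j (lookup⇒[]= q ⁅ j ⁆ (Equivalence.to T-≡ h))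

T-lookup-⁅⁆⁺ : ∀ {k} (j : Fin k) → T (lookup ⁅ j ⁆ j)
T-lookup-⁅⁆⁺ j = Equivalence.from T-≡ ([]=⇒lookup (x∈⁅x⁆ j))

isMin⇒singleton : ∀ {k} (M : Subset k) → T (isMin k M) → ∃ λ j → M ≡ ⁅ j ⁆
isMin⇒singleton {k} M isMin-M
  with satisfiable , minimal ← T-∧⁻ {satNegGBA k M} isMin-M
  with j , Mj ← satisfied (Any.any⁻ _ (allFin k) satisfiable)
  = j , Pointwise-≡⇒≡ (ext pointwise)
  where
  ⁅j⁆⊆M : T (⁅ j ⁆ ⊆ᵇ M)
  ⁅j⁆⊆M = All.all⁻ (λ q → not (lookup ⁅ j ⁆ q) ∨ lookup M q)
    (All.universal (λ q → T-⇒-intro λ h → subst (T ∘ lookup M) (sym (T-lookup-⁅⁆⁻ h)) Mj)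
                   (allFin k))
  ⁅j⁆-satisfiable : T (satNegGBA k ⁅ j ⁆)
  ⁅j⁆-satisfiable = Any.any⁺ _ (lose (∈-allFin j) (T-lookup-⁅⁆⁺ j))
  M⊆⁅j⁆ : T (M ⊆ᵇ ⁅ j ⁆)
  M⊆⁅j⁆ = T-⇒ (T-all⁻ _ minimal (∈-allSubsets ⁅ j ⁆))
                (Equivalence.from T-∧ (⁅j⁆⊆M , ⁅j⁆-satisfiable))
  pointwise : ∀ q → lookup M q ≡ lookup ⁅ j ⁆ q
  pointwise q with q Fin.≟ j
  ... | yes refl = trans (Equivalence.to T-≡ Mj) (sym (Equivalence.to T-≡ (T-lookup-⁅⁆⁺ j)))
  ... | no  q≢j  =
    trans (¬T⇒≡false λ Mq → q≢j (T-lookup-⁅⁆⁻ (T-⇒ (T-all⁻ _ M⊆⁅j⁆ (∈-allFin q)) Mq)))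
          (sym (¬T⇒≡false (q≢j ∘ T-lookup-⁅⁆⁻)))

tightFunctions : (m : ℕ) → List (Vec ℕ m)
tightFunctions m = filterᵇ (isTightFun m) (allVecs (upTo (m + m)) m)

record TightWithRank {m : ℕ} (g : Vec ℕ m) (R : ℕ) : Set where
  field
    rank-odd : T (isOdd R)
    bounded  : ∀ q → lookup g q ≤ R
    odd-hit  : ∀ {o} → o ≤ R → T (isOdd o) → ∃ λ q → lookup g q ≡ o

∈-tightFunctions : ∀ {m R} {g : Vec ℕ m} → TightWithRank g R → R < m + m → g ∈ tightFunctions m
∈-tightFunctions {m} {R} {g} tight R<2m =
  ∈-filter⁺ (T? ∘ isTightFun m) (∈-allVecs⁺ _ g λ q → ∈-upTo⁺ (≤-<-trans (bounded q) R<2m))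
            isTightFun-g
  where
  open TightWithRank tight
  isTightFun-g : T (isTightFun m g)
  isTightFun-g rewrite rank≡ g bounded (odd-hit ≤-refl rank-odd) =
    Equivalence.from T-∧ (rank-odd , All.all⁻ _ (All.tabulate λ o∈ → T-⇒-intro λ o-odd →
      let q , gq≡o = odd-hit (≤-pred (∈-upTo⁻ o∈)) o-odd
      in  Any.any⁺ _ (lose (∈-allFin q) (≡⇒≡ᵇ _ _ gq≡o))))

mark : ∀ {n} → Subset n → Vec ℕ n → Vec ℕ n
mark = Vec.zipWith (λ b x → if b then 1 else x)

unmark : ∀ {n} → ℕ → Vec ℕ n → Vec ℕ n
unmark g₀ = Vec.map (λ x → if x ≡ᵇ 1 then g₀ else x)

indexOf1 : ∀ {n} → Vec ℕ n → ℕ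
indexOf1 []      = 0
indexOf1 (x ∷ v) = if x ≡ᵇ 1 then 0 else suc (indexOf1 v)

≢⇒≡ᵇ-false : ∀ {x y} → x ≢ y → (x ≡ᵇ y) ≡ false
≢⇒≡ᵇ-false {x} {y} x≢y = ¬T⇒≡false (x≢y ∘ ≡ᵇ⇒≡ x y)

module _ {n : ℕ} (M : Subset n) (c : Vec ℕ n) where

  lookup-mark : ∀ q → lookup (mark M c) q ≡ (if lookup M q then 1 else lookup c q)
  lookup-mark q = lookup-zipWith _ q M c

  lookup-mark-marked : ∀ {q} → lookup M q ≡ true → lookup (mark M c) q ≡ 1
  lookup-mark-marked {q} Mq = trans (lookup-mark q) (cong (λ b → if b then 1 else lookup c q) Mq)

  lookup-mark-unmarked : ∀ {q} → lookup M q ≡ false → lookup (mark M c) q ≡ lookup c q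
  lookup-mark-unmarked {q} Mq = trans (lookup-mark q) (cong (λ b → if b then 1 else lookup c q) Mq)

module _ {n : ℕ} (M : Subset n) {c : Vec ℕ n} (c≢1 : ∀ q → lookup c q ≢ 1) where

  marked-mark : Vec.map (_≡ᵇ 1) (mark M c) ≡ M
  marked-mark = Pointwise-≡⇒≡ (ext λ q → trans (lookup-map q _ (mark M c)) (marked q))
    where
    marked : ∀ q → (lookup (mark M c) q ≡ᵇ 1) ≡ lookup M q
    marked q with lookup M q in Mq
    ... | true  = cong (_≡ᵇ 1) (lookup-mark-marked M c Mq)
    ... | false = trans (cong (_≡ᵇ 1) (lookup-mark-unmarked M c Mq)) (≢⇒≡ᵇ-false (c≢1 q))

  unmark-mark : ∀ {g₀} → (∀ q → lookup M q ≡ true → lookup c q ≡ g₀) → unmark g₀ (mark M c) ≡ c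
  unmark-mark {g₀} marked-g₀ = Pointwise-≡⇒≡ (ext λ q → trans (lookup-map q _ (mark M c)) (restored q))
    where
    restored : ∀ q → (if lookup (mark M c) q ≡ᵇ 1 then g₀ else lookup (mark M c) q) ≡ lookup c q
    restored q with lookup M q in Mq
    ... | true  rewrite lookup-mark-marked M c Mq = sym (marked-g₀ q Mq)
    ... | false rewrite lookup-mark-unmarked M c Mq | ≢⇒≡ᵇ-false (c≢1 q) = refl

  -- Every entry of c survives, either in place or as the head g₀.
  mark-tight : ∀ {g₀ R} → T (isOdd R) → (∀ q → lookup c q ≤ R) →
    (∀ {o} → 1 < o → o ≤ R → T (isOdd o) → ∃ λ q → lookup c q ≡ o) →
    (∃ λ q → lookup M q ≡ true) → (∀ q → lookup M q ≡ true → lookup c q ≡ g₀) →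
    TightWithRank (g₀ ∷ mark M c) R
  mark-tight {g₀} {R} R-odd c≤R c-odd (q₀ , Mq₀) marked-g₀ = record
    { rank-odd = R-odd
    ; bounded  = bounded
    ; odd-hit  = odd-hit
    }
    where
    appears : ∀ q → ∃ λ q' → lookup (g₀ ∷ mark M c) q' ≡ lookup c q
    appears q with lookup M q in Mq
    ... | true  = zero , sym (marked-g₀ q Mq)
    ... | false = suc q , lookup-mark-unmarked M c Mq
    bounded : ∀ q → lookup (g₀ ∷ mark M c) q ≤ R
    bounded zero    = subst (_≤ R) (marked-g₀ q₀ Mq₀) (c≤R q₀)
    bounded (suc q) with lookup M q in Mq
    ... | true  = subst (_≤ R) (sym (lookup-mark-marked M c Mq)) (odd⇒1≤ R-odd)
    ... | false = subst (_≤ R) (sym (lookup-mark-unmarked M c Mq)) (c≤R q)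
    odd-hit : ∀ {o} → o ≤ R → T (isOdd o) → ∃ λ q → lookup (g₀ ∷ mark M c) q ≡ o
    odd-hit {1}           _  _     = suc q₀ , lookup-mark-marked M c Mq₀
    odd-hit {suc (suc o)} o≤ o-odd with q , cq≡o ← c-odd (s≤s (s≤s z≤n)) o≤ o-odd
                                   with q' , g≡cq ← appears q = q' , trans g≡cq cq≡o

indexOf1-mark-⁅⁆ : ∀ {n} {c : Vec ℕ n} → (∀ q → lookup c q ≢ 1) → ∀ p → indexOf1 (mark ⁅ p ⁆ c) ≡ toℕ p
indexOf1-mark-⁅⁆ {c = x ∷ c} c≢1 zero    = refl
indexOf1-mark-⁅⁆ {c = x ∷ c} c≢1 (suc p) rewrite ≢⇒≡ᵇ-false (c≢1 zero) =
  cong suc (indexOf1-mark-⁅⁆ (c≢1 ∘ suc) p)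

stateCode : ∀ {n} → Subset n → LevelRanking n → Vec ℕ n
stateCode = Vec.zipWith (λ s w → if s then suc (suc w) else 0)

decodeQ2 : ∀ {n k} → Bool × Vec (Fin k) n × Vec ℕ (suc n) → Q2Tuple n k
decodeQ2 (t , ν , g₀ ∷ v) =
  Vec.map (λ x → not (x ≡ᵇ 0)) c , (if t then Vec.map (_≡ᵇ 1) v else ⊥) , Vec.map (_∸ 2) c ,
  (if t then g₀ ∸ 2 else 2 * indexOf1 v) , Vec.map ⁅_⁆ ν
  where c = unmark g₀ v

codes : (n k : ℕ) → List (Bool × Vec (Fin k) n × Vec ℕ (suc n))
codes n k =
  cartesianProduct (true ∷ false ∷ []) (cartesianProduct (allVecs (allFin k) n) (tightFunctions (suc n)))

module _ {n k : ℕ} {S O : Subset n} {f : LevelRanking n} {i : ℕ} {μ : LevelModel n k}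
         (st : IsQ2State S O f i μ) where
  open IsQ2State st

  private
    code : Vec ℕ n
    code = stateCode S f

    lookup-code : ∀ q → lookup code q ≡ (if lookup S q then suc (suc (lookup f q)) else 0)
    lookup-code q = lookup-zipWith _ q S f

    code-member : ∀ {q} → lookup S q ≡ true → lookup code q ≡ suc (suc (lookup f q))
    code-member {q} Sq rewrite lookup-code q | Sq = refl

    code≢1 : ∀ q → lookup code q ≢ 1
    code≢1 q rewrite lookup-code q with lookup S q
    ... | true  = λ ()
    ... | false = λ ()

    code≤ : ∀ q → lookup code q ≤ suc (suc (rank f))
    code≤ q rewrite lookup-code q with lookup S q
    ... | true  = s≤s (s≤s (lookup≤rank f q))
    ... | false = z≤n

    decode-S : Vec.map (λ x → not (x ≡ᵇ 0)) code ≡ S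
    decode-S = Pointwise-≡⇒≡ (ext λ q → trans (lookup-map q _ code) (member q))
      where
      member : ∀ q → not (lookup code q ≡ᵇ 0) ≡ lookup S q
      member q rewrite lookup-code q with lookup S q
      ... | true  = refl
      ... | false = refl

    decode-f : Vec.map (_∸ 2) code ≡ f
    decode-f = Pointwise-≡⇒≡ (ext λ q → trans (lookup-map q _ code) (value q))
      where
      value : ∀ q → lookup code q ∸ 2 ≡ lookup f q
      value q rewrite lookup-code q with lookup S q in Sq
      ... | true  = refl
      ... | false = sym (outside-zero q Sq)

    models : ∃ λ ν → Vec.map ⁅_⁆ ν ≡ μ
    models = ν , Pointwise-≡⇒≡ (ext λ q → begin
      lookup (Vec.map ⁅_⁆ ν) q  ≡⟨ lookup-map q ⁅_⁆ ν ⟩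
      ⁅ lookup ν q ⁆            ≡⟨ cong ⁅_⁆ (lookup∘tabulate (proj₁ ∘ singleton) q) ⟩
      ⁅ proj₁ (singleton q) ⁆   ≡⟨ sym (proj₂ (singleton q)) ⟩
      lookup μ q                ∎)
      where
      open ≡-Reasoning
      singleton : ∀ q → ∃ λ j → lookup μ q ≡ ⁅ j ⁆
      singleton q = isMin⇒singleton (lookup μ q) (μ-minimal q)
      ν : Vec (Fin k) n
      ν = Vec.tabulate (proj₁ ∘ singleton)

    ν : Vec (Fin k) n
    ν = proj₁ models

    ν-decodes : Vec.map ⁅_⁆ ν ≡ μ
    ν-decodes = proj₂ models

    R<2[1+n] : suc (suc (rank f)) < suc n + suc n
    R<2[1+n] = subst (suc (suc (rank f)) <_) (sym (cong suc (+-suc n n))) (s≤s (s≤s rank<2n))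

    ∈codes : ∀ {t} {g : Vec ℕ (suc n)} → TightWithRank g (suc (suc (rank f))) →
      (t , ν , g) ∈ codes n k
    ∈codes {t} tight = ∈-cartesianProduct⁺ (∈-Bool t)
      (∈-cartesianProduct⁺ (∈-allVecs⁺ _ ν λ _ → ∈-allFin _) (∈-tightFunctions tight R<2[1+n]))

    decoded-S : ∀ {M g₀} → (∀ q → lookup M q ≡ true → lookup code q ≡ g₀) →
      Vec.map (λ x → not (x ≡ᵇ 0)) (unmark g₀ (mark M code)) ≡ S
    decoded-S {M} marked-g₀ = trans (cong (Vec.map _) (unmark-mark M code≢1 marked-g₀)) decode-S

    decoded-f : ∀ {M g₀} → (∀ q → lookup M q ≡ true → lookup code q ≡ g₀) →
      Vec.map (_∸ 2) (unmark g₀ (mark M code)) ≡ f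
    decoded-f {M} marked-g₀ = trans (cong (Vec.map _) (unmark-mark M code≢1 marked-g₀)) decode-f

    code-odd : ∀ {o} → 1 < o → o ≤ suc (suc (rank f)) → T (isOdd o) → ∃ λ q → lookup code q ≡ o
    code-odd {suc (suc o)} (s≤s (s≤s _)) o≤ o-odd
      with q , Sq , fq≡o ← odd-attained (≤-pred (≤-pred o≤)) o-odd =
      q , trans (code-member Sq) (cong (2 +_) fq≡o)

    tight-marking : ∀ {M g₀} → (∃ λ q → lookup M q ≡ true) →
      (∀ q → lookup M q ≡ true → lookup code q ≡ g₀) → TightWithRank (g₀ ∷ mark M code) (suc (suc (rank f)))
    tight-marking {M} = mark-tight M code≢1 rank-odd code≤ code-odd

  encodeQ2 : ∃ λ y → y ∈ codes n k × decodeQ2 y ≡ (S , O , f , i , μ)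
  encodeQ2 with Fin.any? (λ q → lookup O q Bool.≟ true)
  ... | yes O-nonempty =
    (true , ν , suc (suc i) ∷ mark O code) , ∈codes (tight-marking O-nonempty O-marked) ,
    cong₂ _,_ (decoded-S O-marked) (cong₂ _,_ (marked-mark O code≢1)
      (cong₂ _,_ (decoded-f O-marked) (cong₂ _,_ refl ν-decodes)))
    where
    O-marked : ∀ q → lookup O q ≡ true → lookup code q ≡ suc (suc i)
    O-marked q Oq with Sq , fq≡i ← O-level q Oq = trans (code-member Sq) (cong (2 +_) fq≡i)
  ... | no O-empty =
    (false , ν , lookup code level ∷ mark ⁅ level ⁆ code) ,
    ∈codes (tight-marking (level , Equivalence.to T-≡ (T-lookup-⁅⁆⁺ level)) level-marked) ,
    cong₂ _,_ (decoded-S level-marked) (cong₂ _,_ ⊥≡O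
      (cong₂ _,_ (decoded-f level-marked) (cong₂ _,_ decoded-i ν-decodes)))
    where
    level-marked : ∀ q → lookup ⁅ level ⁆ q ≡ true → lookup code q ≡ lookup code level
    level-marked q h = cong (lookup code) (T-lookup-⁅⁆⁻ (Equivalence.from T-≡ h))
    ⊥≡O : ⊥ ≡ O
    ⊥≡O = Pointwise-≡⇒≡ (ext λ q → trans (lookup-replicate q false)
      (sym (¬T⇒≡false λ Oq → O-empty (q , Equivalence.to T-≡ Oq))))
    decoded-i : 2 * indexOf1 (mark ⁅ level ⁆ code) ≡ i
    decoded-i = trans (cong (2 *_) (indexOf1-mark-⁅⁆ code≢1 level)) (sym i≡level)

numQ2≤ : ∀ n k → numQ2 n k ≤ 2 * (k ^ n * tight (suc n))
numQ2≤ n k = begin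
  numQ2 n k
    ≤⟨ Unique∧⊆⇒length≤ (Unique.filter⁺ _ (q2Candidates-Unique n k)) Q2⊆decoded ⟩
  length (map decodeQ2 (codes n k))
    ≡⟨ length-map decodeQ2 (codes n k) ⟩
  length (codes n k)
    ≡⟨ length-codes ⟩
  2 * (k ^ n * tight (suc n)) ∎
  where
  open ≤-Reasoning
  Q2⊆decoded : filterᵇ (isQ2 n k) (q2Candidates n k) ⊆ map decodeQ2 (codes n k)
  Q2⊆decoded x∈Q2
    with x∈candidates , isQ2-x ← ∈-filter⁻ (T? ∘ isQ2 n k) {xs = q2Candidates n k} x∈Q2
    with f∈ , i∈ ← All.lookup (q2Candidates-ranges n k) x∈candidates
    with y , y∈codes , y↦x ← encodeQ2 (isQ2⇒IsQ2State isQ2-x f∈ i∈)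
    = subst (_∈ map decodeQ2 (codes n k)) y↦x (∈-map⁺ decodeQ2 y∈codes)
  length-codes : length (codes n k) ≡ 2 * (k ^ n * tight (suc n))
  length-codes = begin-equality
    length (codes n k)
      ≡⟨ length-cartesianProduct (true ∷ false ∷ []) (cartesianProduct models (tightFunctions (suc n))) ⟩
    2 * length (cartesianProduct models (tightFunctions (suc n)))
      ≡⟨ cong (2 *_) (length-cartesianProduct models (tightFunctions (suc n))) ⟩
    2 * (length models * tight (suc n))
      ≡⟨ cong (λ m → 2 * (m * tight (suc n))) (trans (length-allVecs (allFin k) n) (cong (_^ n) (length-tabulate id))) ⟩
    2 * (k ^ n * tight (suc n)) ∎
    where models = allVecs (allFin k) n

length-allSubsets≤ : ∀ n → length (allSubsets n) ≤ tight (suc n)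
length-allSubsets≤ n = begin
  length (allSubsets n)                         ≤⟨ Unique∧⊆⇒length≤ (allSubsets-Unique n) subsets⊆decoded ⟩
  length (map decode (tightFunctions (suc n)))  ≡⟨ length-map decode (tightFunctions (suc n)) ⟩
  tight (suc n)                                 ∎
  where
  open ≤-Reasoning
  zeros : Vec ℕ n
  zeros = Vec.replicate n 0
  zeros≢1 : ∀ q → lookup zeros q ≢ 1
  zeros≢1 q eq with () ← trans (sym (lookup-replicate q 0)) eq
  decode : Vec ℕ (suc n) → Subset n
  decode g = Vec.map (_≡ᵇ 1) (Vec.tail g)
  tight-marking : ∀ M → TightWithRank (1 ∷ mark M zeros) 1
  tight-marking M = record
    { rank-odd = _
    ; bounded  = bounded
    ; odd-hit  = λ { {1} _ _ → zero , refl ; {suc (suc _)} (s≤s ()) _ }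
    }
    where
    bounded : ∀ q → lookup (1 ∷ mark M zeros) q ≤ 1
    bounded zero    = ≤-refl
    bounded (suc q) with lookup M q in Mq
    ... | true  = ≤-reflexive (lookup-mark-marked M zeros Mq)
    ... | false = subst (_≤ 1) (sym (trans (lookup-mark-unmarked M zeros Mq) (lookup-replicate q 0))) z≤n
  1<2[1+n] : 1 < suc n + suc n
  1<2[1+n] = s≤s (≤-trans (s≤s z≤n) (m≤n+m (suc n) n))
  subsets⊆decoded : allSubsets n ⊆ map decode (tightFunctions (suc n))
  subsets⊆decoded {M} _ = subst (_∈ map decode (tightFunctions (suc n))) (marked-mark M zeros≢1)
    (∈-map⁺ decode (∈-tightFunctions (tight-marking M) 1<2[1+n]))

corollary3 : Σ ℕ λ C → (A : GBA) → 1 ≤ GBA.k A →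
    numStatesB A ≤ C * (GBA.k A ^ GBA.n A * tight (suc (GBA.n A)))
corollary3 = 3 , λ A 1≤k → let open GBA A; open ≤-Reasoning in begin
  length (allSubsets n) + numQ2 n k
    ≤⟨ +-mono-≤ (length-allSubsets≤ n) (numQ2≤ n k) ⟩
  tight (suc n) + 2 * (k ^ n * tight (suc n))
    ≤⟨ +-monoˡ-≤ _ (m≤n*m (tight (suc n)) (k ^ n) {{m^n≢0 k n {{>-nonZero 1≤k}}}}) ⟩
  3 * (k ^ n * tight (suc n)) ∎
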